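{- For any nontrivial connected graph $G$, $\gamma_t(G)\le \gamma_{qtR}(G)\le 2\gamma_t(G)$. Furthermore: (i) $\gamma_{qtR}(G)=\gamma_t(G)$ if and only if $G\cong P_2$; (ii) $\gamma_{qtR}(G)=\gamma_t(G)+1$ if and only if $\gamma_{qtR}(G)=3$; (iii) $\gamma_{qtR}(G)=2\gamma_t(G)$ if and only if $\gamma_{qtR}(G)=\gamma_{tR}(G)$ and $\gamma_{tR}(G)=2\gamma_t(G)$.
   Context: All graphs are finite, simple and undirected. $\gamma_t(G)$ is the total domination number: the minimum size of a set $S$ such that every vertex of $G$ has a neighbor in $S$. For $f:V(G)\to\{0,1,2\}$ write $V_i=\{v:f(v)=i\}$; the weight is $\sum_v f(v)$. A Roman dominating function (RDF) is such an $f$ where every vertex labeled $0$ has a neighbor labeled $2$. A total Roman dominating function (TRDF) is an RDF such that the subgraph induced by $\{v:f(v)\ne0\}$ has no isolated vertices; $\gamma_{tR}(G)$ is its minimum weight. A quasi-total Roman dominating function (QTRDF) is a function $f:V(G)\to\{0,1,2\}$ such that every vertex $u$ with $f(u)=0$ is adjacent to some $v$ with $f(v)=2$, and every vertex $x$ that is isolated in the subgraph induced by $V_1\cup V_2$ satisfies $f(x)=1$. $\gamma_{qtR}(G)$ is the minimum weight of a QTRDF on $G$. -}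

module Defs where

open import Data.Nat using (ℕ; zero; suc; _+_; _*_; _≤_)
open import Data.Fin using (Fin; zero; suc)
open import Data.Fin.Subset using (Subset; _∈_; ∣_∣)
open import Data.Bool using (Bool; true; false)
open import Data.Product using (Σ; ∃; _×_; _,_)
open import Relation.Binary.PropositionalEquality using (_≡_; _≢_)
open import Relation.Nullary using (¬_)
open import Function.Bundles using (_↔_; Inverse)

record Graph : Set where
  field
    n       : ℕ
    adj     : Fin n → Fin n → Bool
    sym     : ∀ u v → adj u v ≡ adj v u
    irrefl  : ∀ v → adj v v ≡ false

open Graph public

Adj : (G : Graph) → Fin (n G) → Fin (n G) → Set
Adj G u v = adj G u v ≡ true

data Reach (G : Graph) : Fin (n G) → Fin (n G) → Set where
  here : ∀ {u} → Reach G u u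
  step : ∀ {u v w} → Adj G u v → Reach G v w → Reach G u w

Connected : Graph → Set
Connected G = ∀ u v → Reach G u v

Nontrivial : Graph → Set
Nontrivial G = 2 ≤ n G

_≅_ : Graph → Graph → Set
G ≅ H = Σ (Fin (n G) ↔ Fin (n H)) λ φ →
          ∀ u v → adj H (Inverse.to φ u) (Inverse.to φ v) ≡ adj G u v

p2adj : Fin 2 → Fin 2 → Bool
p2adj zero zero = false
p2adj zero (suc zero) = true
p2adj (suc zero) zero = true
p2adj (suc zero) (suc zero) = false

p2sym : ∀ u v → p2adj u v ≡ p2adj v u
p2sym zero zero = Relation.Binary.PropositionalEquality.refl
p2sym zero (suc zero) = Relation.Binary.PropositionalEquality.refl
p2sym (suc zero) zero = Relation.Binary.PropositionalEquality.refl
p2sym (suc zero) (suc zero) = Relation.Binary.PropositionalEquality.refl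

p2irr : ∀ v → p2adj v v ≡ false
p2irr zero = Relation.Binary.PropositionalEquality.refl
p2irr (suc zero) = Relation.Binary.PropositionalEquality.refl

P₂ : Graph
P₂ = record { n = 2 ; adj = p2adj ; sym = p2sym ; irrefl = p2irr }

IsTotalDominating : (G : Graph) → Subset (n G) → Set
IsTotalDominating G S = ∀ v → ∃ λ u → Adj G v u × u ∈ S

IsTotalDomNumber : Graph → ℕ → Set
IsTotalDomNumber G k =
  (Σ (Subset (n G)) λ S → IsTotalDominating G S × ∣ S ∣ ≡ k) ×
  (∀ S → IsTotalDominating G S → k ≤ ∣ S ∣)

data Label : Set where
  L0 L1 L2 : Label

val : Label → ℕ
val L0 = 0
val L1 = 1
val L2 = 2

sumFin : ∀ {m} → (Fin m → ℕ) → ℕ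
sumFin {zero} f = 0
sumFin {suc m} f = f zero + sumFin (λ i → f (suc i))

weight : (G : Graph) → (Fin (n G) → Label) → ℕ
weight G f = sumFin (λ v → val (f v))

IsRDF : (G : Graph) → (Fin (n G) → Label) → Set
IsRDF G f = ∀ u → f u ≡ L0 → ∃ λ v → Adj G u v × f v ≡ L2

-- isolated in the subgraph induced by V₁ ∪ V₂ (x itself in V₁ ∪ V₂)
IsolatedInPositive : (G : Graph) → (Fin (n G) → Label) → Fin (n G) → Set
IsolatedInPositive G f x = f x ≢ L0 × (∀ y → Adj G x y → f y ≡ L0)

IsTRDF : (G : Graph) → (Fin (n G) → Label) → Set
IsTRDF G f = IsRDF G f × (∀ x → ¬ IsolatedInPositive G f x)

IsQTRDF : (G : Graph) → (Fin (n G) → Label) → Set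
IsQTRDF G f = IsRDF G f × (∀ x → IsolatedInPositive G f x → f x ≡ L1)

IsTRDNumber : Graph → ℕ → Set
IsTRDNumber G k =
  (Σ (Fin (n G) → Label) λ f → IsTRDF G f × weight G f ≡ k) ×
  (∀ f → IsTRDF G f → k ≤ weight G f)

IsQTRDNumber : Graph → ℕ → Set
IsQTRDNumber G k =
  (Σ (Fin (n G) → Label) λ f → IsQTRDF G f × weight G f ≡ k) ×
  (∀ f → IsQTRDF G f → k ≤ weight G f)

-- Doubling a minimum total dominating set gives a TRDF, so γqtR ≤ γtR ≤ 2γt. Conversely, on a
-- connected graph of order at least 3, a QTRDF f of weight w yields a total dominating set S with
-- |S| + 2 ≤ w, or with |S| ≤ 2 and w ≥ 3. If |V₂| ≥ 2, take V₂ together with, for each vertex of V₁,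
-- the vertex itself or one of its neighbours. Otherwise choose v (the vertex labelled 2, or a vertex
-- of degree at least 2 when no label is 2); then |V ∖ N[v]| + 3 ≤ w, and v, one neighbour z of v and
-- one neighbour of each vertex of V ∖ N[v] except one adjacent to z form a total dominating set of
-- size at most max(2, |V ∖ N[v]| + 1). On two vertices the graph is P₂ and γt = γqtR = 2, and the
-- three characterisations follow by arithmetic.
module Submission where

open import Defs hiding (sym)
open import Data.Nat using (ℕ; zero; suc; _+_; _*_; _≤_; _<_; z≤n; s≤s; _≤?_)
open import Data.Nat.Properties
open import Data.Nat.Solver using (module +-*-Solver)
open +-*-Solver using (solve; _:+_; _:*_; _:=_; con)
open import Data.Fin using (Fin; zero; suc; fromℕ<)
import Data.Fin.Properties as Finₚ
open import Data.Fin.Subset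
  using (Subset; inside; outside; _∈_; _∉_; _⊆_; _∪_; _-_; ⁅_⁆; ∁; ⊤; ⊥; ∣_∣)
open import Data.Fin.Subset.Properties
open import Data.Vec using ([]; _∷_; tabulate; lookup; here; there)
open import Data.Vec.Properties using (lookup∘tabulate; []=⇒lookup; lookup⇒[]=)
import Data.Bool as Bool
open import Data.Bool using (true; if_then_else_)
open import Data.Product using (∃; ∃₂; _×_; _,_; proj₁; proj₂)
open import Data.Sum using (_⊎_; inj₁; inj₂; [_,_]′)
open import Data.Empty using (⊥-elim)
open import Function using (_∘_; id; _⇔_; mk⇔; mk↔ₛ′; Equivalence)
open import Data.Fin.Permutation using (↔⇒≡)
open import Relation.Binary.PropositionalEquality
  using (_≡_; _≢_; refl; sym; trans; cong; subst)
open import Relation.Binary.Definitions using (DecidableEquality)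
open import Relation.Nullary using (¬_; Dec; yes; no; does; ¬?; _×-dec_; _⊎-dec_)
open import Relation.Nullary.Decidable using (dec-true; decidable-stable)
open import Relation.Nullary.Negation using (contradiction)
open import Relation.Unary using (Pred; Decidable)

private
  variable
    m : ℕ
    p : Subset m

subsetOf : ∀ {ℓ} {P : Pred (Fin m) ℓ} → Decidable P → Subset m
subsetOf P? = tabulate (does ∘ P?)

module _ {ℓ} {P : Pred (Fin m) ℓ} (P? : Decidable P) {x : Fin m} where

  ∈subsetOf⁺ : P x → x ∈ subsetOf P?
  ∈subsetOf⁺ px = lookup⇒[]= x _ (trans (lookup∘tabulate _ x) (dec-true (P? x) px))

  ∈subsetOf⁻ : x ∈ subsetOf P? → P x
  ∈subsetOf⁻ x∈ with P? x | trans (sym (lookup∘tabulate (does ∘ P?) x)) ([]=⇒lookup x∈)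
  ... | yes px | _ = px
  ... | no _ | ()

module _ (x y : Fin m) where

  pair : Subset m
  pair = subsetOf (λ z → z Finₚ.≟ x ⊎-dec z Finₚ.≟ y)

  ∈pair⁺ : ∀ {z} → z ≡ x ⊎ z ≡ y → z ∈ pair
  ∈pair⁺ = ∈subsetOf⁺ (λ z → z Finₚ.≟ x ⊎-dec z Finₚ.≟ y)

  ∈pair⁻ : ∀ {z} → z ∈ pair → z ≡ x ⊎ z ≡ y
  ∈pair⁻ = ∈subsetOf⁻ (λ z → z Finₚ.≟ x ⊎-dec z Finₚ.≟ y)

∣p∪q∣≤∣p∣+∣q∣ : ∀ (p q : Subset m) → ∣ p ∪ q ∣ ≤ ∣ p ∣ + ∣ q ∣
∣p∪q∣≤∣p∣+∣q∣ [] [] = z≤n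
∣p∪q∣≤∣p∣+∣q∣ (inside ∷ p) (inside ∷ q) = s≤s (≤-trans (∣p∪q∣≤∣p∣+∣q∣ p q) (+-monoʳ-≤ ∣ p ∣ (n≤1+n ∣ q ∣)))
∣p∪q∣≤∣p∣+∣q∣ (inside ∷ p) (outside ∷ q) = s≤s (∣p∪q∣≤∣p∣+∣q∣ p q)
∣p∪q∣≤∣p∣+∣q∣ (outside ∷ p) (inside ∷ q) = subst (suc ∣ p ∪ q ∣ ≤_) (sym (+-suc ∣ p ∣ ∣ q ∣)) (s≤s (∣p∪q∣≤∣p∣+∣q∣ p q))
∣p∪q∣≤∣p∣+∣q∣ (outside ∷ p) (outside ∷ q) = ∣p∪q∣≤∣p∣+∣q∣ p q

∣⁅x⁆∪p∣≤1+∣p∣ : ∀ (x : Fin m) (p : Subset m) → ∣ ⁅ x ⁆ ∪ p ∣ ≤ suc ∣ p ∣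
∣⁅x⁆∪p∣≤1+∣p∣ x p = ≤-trans (∣p∪q∣≤∣p∣+∣q∣ ⁅ x ⁆ p) (≤-reflexive (cong (_+ ∣ p ∣) (∣⁅x⁆∣≡1 x)))

image : ∀ {m k} → (Fin m → Fin k) → Subset m → Subset k
image g [] = ⊥
image g (inside ∷ p) = ⁅ g zero ⁆ ∪ image (g ∘ suc) p
image g (outside ∷ p) = image (g ∘ suc) p

∣image∣≤∣p∣ : ∀ {m k} (g : Fin m → Fin k) (p : Subset m) → ∣ image g p ∣ ≤ ∣ p ∣
∣image∣≤∣p∣ {k = k} g [] = ≤-reflexive (∣⊥∣≡0 k)
∣image∣≤∣p∣ g (inside ∷ p) = ≤-trans (∣⁅x⁆∪p∣≤1+∣p∣ (g zero) _) (s≤s (∣image∣≤∣p∣ (g ∘ suc) p))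
∣image∣≤∣p∣ g (outside ∷ p) = ∣image∣≤∣p∣ (g ∘ suc) p

∈image⁺ : ∀ {m k} (g : Fin m → Fin k) {p : Subset m} {x : Fin m} → x ∈ p → g x ∈ image g p
∈image⁺ g {inside ∷ p} here = x∈p∪q⁺ (inj₁ (x∈⁅x⁆ (g zero)))
∈image⁺ g {inside ∷ p} (there x∈p) = x∈p∪q⁺ (inj₂ (∈image⁺ (g ∘ suc) x∈p))
∈image⁺ g {outside ∷ p} (there x∈p) = ∈image⁺ (g ∘ suc) x∈p

x∈p⇒0<∣p∣ : ∀ {x} → x ∈ p → 0 < ∣ p ∣
x∈p⇒0<∣p∣ x∈p = ≤-trans (s≤s z≤n) (x∈p⇒∣p-x∣<∣p∣ x∈p)

x∈p∧y∈p∧x≢y⇒2≤∣p∣ : ∀ {x y} → x ∈ p → y ∈ p → x ≢ y → 2 ≤ ∣ p ∣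
x∈p∧y∈p∧x≢y⇒2≤∣p∣ x∈p y∈p x≢y =
  ≤-trans (s≤s (x∈p⇒0<∣p∣ (x∈p∧x≢y⇒x∈p-y y∈p (x≢y ∘ sym)))) (x∈p⇒∣p-x∣<∣p∣ x∈p)

∣p∣≤1∧x∈p∧y∈p⇒x≡y : ∣ p ∣ ≤ 1 → ∀ {x y} → x ∈ p → y ∈ p → x ≡ y
∣p∣≤1∧x∈p∧y∈p⇒x≡y ∣p∣≤1 {x} {y} x∈p y∈p =
  decidable-stable (x Finₚ.≟ y) (λ x≢y → <⇒≱ (x∈p∧y∈p∧x≢y⇒2≤∣p∣ x∈p y∈p x≢y) ∣p∣≤1)

avoid-one : ∀ {m} → 2 ≤ m → (x : Fin m) → ∃ λ z → z ≢ x
avoid-one {1} (s≤s ()) _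
avoid-one {suc (suc _)} _ zero = suc zero , λ ()
avoid-one {suc (suc _)} _ (suc _) = zero , λ ()

avoid-two : ∀ {m} → 3 ≤ m → (x y : Fin m) → ∃ λ z → z ≢ x × z ≢ y
avoid-two {1} (s≤s ()) _ _
avoid-two {2} (s≤s (s≤s ())) _ _
avoid-two {suc (suc (suc _))} _ zero zero = suc zero , (λ ()) , (λ ())
avoid-two {suc (suc (suc _))} _ zero (suc zero) = suc (suc zero) , (λ ()) , (λ ())
avoid-two {suc (suc (suc _))} _ zero (suc (suc _)) = suc zero , (λ ()) , (λ ())
avoid-two {suc (suc (suc _))} _ (suc zero) zero = suc (suc zero) , (λ ()) , (λ ())
avoid-two {suc (suc (suc _))} _ (suc (suc _)) zero = suc zero , (λ ()) , (λ ())
avoid-two {suc (suc (suc _))} _ (suc _) (suc _) = zero , (λ ()) , (λ ())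

_≟ᴸ_ : DecidableEquality Label
L0 ≟ᴸ L0 = yes refl
L0 ≟ᴸ L1 = no λ ()
L0 ≟ᴸ L2 = no λ ()
L1 ≟ᴸ L0 = no λ ()
L1 ≟ᴸ L1 = yes refl
L1 ≟ᴸ L2 = no λ ()
L2 ≟ᴸ L0 = no λ ()
L2 ≟ᴸ L1 = no λ ()
L2 ≟ᴸ L2 = yes refl

≢L0∧≢L2⇒≡L1 : ∀ {l} → l ≢ L0 → l ≢ L2 → l ≡ L1
≢L0∧≢L2⇒≡L1 {L0} l≢L0 _ = ⊥-elim (l≢L0 refl)
≢L0∧≢L2⇒≡L1 {L1} _ _ = refl
≢L0∧≢L2⇒≡L1 {L2} _ l≢L2 = ⊥-elim (l≢L2 refl)

module _ {m : ℕ} (f : Fin m → Label) where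

  V₁ V₂ : Subset m
  V₁ = subsetOf (λ x → f x ≟ᴸ L1)
  V₂ = subsetOf (λ x → f x ≟ᴸ L2)

  ∈V₁⁺ : ∀ {x} → f x ≡ L1 → x ∈ V₁
  ∈V₁⁺ = ∈subsetOf⁺ (λ x → f x ≟ᴸ L1)

  ∈V₂⁺ : ∀ {x} → f x ≡ L2 → x ∈ V₂
  ∈V₂⁺ = ∈subsetOf⁺ (λ x → f x ≟ᴸ L2)

  ∈V₂⁻ : ∀ {x} → x ∈ V₂ → f x ≡ L2
  ∈V₂⁻ = ∈subsetOf⁻ (λ x → f x ≟ᴸ L2)

sumFin-val≡∣V₁∣+2∣V₂∣ : ∀ {m} (f : Fin m → Label) → sumFin (val ∘ f) ≡ ∣ V₁ f ∣ + 2 * ∣ V₂ f ∣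
sumFin-val≡∣V₁∣+2∣V₂∣ {zero} f = refl
sumFin-val≡∣V₁∣+2∣V₂∣ {suc m} f with f zero | sumFin-val≡∣V₁∣+2∣V₂∣ (f ∘ suc)
... | L0 | ih = ih
... | L1 | ih = cong suc ih
... | L2 | ih = trans (cong (2 +_) ih) (solve 2 (λ a b → con 2 :+ (a :+ con 2 :* b) := a :+ con 2 :* (con 1 :+ b))
                                             refl ∣ V₁ (f ∘ suc) ∣ ∣ V₂ (f ∘ suc) ∣)

sumFin-val-L1 : ∀ {m} (f : Fin m → Label) → (∀ x → f x ≡ L1) → sumFin (val ∘ f) ≡ m
sumFin-val-L1 {zero} f _ = refl
sumFin-val-L1 {suc m} f all-L1 rewrite all-L1 zero = cong suc (sumFin-val-L1 (f ∘ suc) (all-L1 ∘ suc))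

twice : ∀ {m} → Subset m → Fin m → Label
twice S x = if lookup S x then L2 else L0

sumFin-val-twice : ∀ {m} (S : Subset m) → sumFin (val ∘ twice S) ≡ 2 * ∣ S ∣
sumFin-val-twice [] = refl
sumFin-val-twice (inside ∷ S) = trans (cong (2 +_) (sumFin-val-twice S)) (sym (*-suc 2 ∣ S ∣))
sumFin-val-twice (outside ∷ S) = sumFin-val-twice S

≅P₂⇒n≡2 : ∀ {G} → G ≅ P₂ → n G ≡ 2
≅P₂⇒n≡2 (φ , _) = ↔⇒≡ φ

n≡2⇒≅P₂ : (G : Graph) → n G ≡ 2 → (∀ x → ∃ (Adj G x)) → G ≅ P₂
n≡2⇒≅P₂ record { n = _ ; adj = adj ; sym = adj-sym ; irrefl = irrefl } refl neighbour =
  mk↔ₛ′ id id (λ _ → refl) (λ _ → refl) , p2adj≡adj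
  where
  adj01 : adj zero (suc zero) ≡ true
  adj01 with neighbour zero
  ... | zero , adj00 = contradiction (trans (sym adj00) (irrefl zero)) λ ()
  ... | suc zero , adj01 = adj01
  p2adj≡adj : ∀ u v → p2adj u v ≡ adj u v
  p2adj≡adj zero zero = sym (irrefl zero)
  p2adj≡adj zero (suc zero) = sym adj01
  p2adj≡adj (suc zero) zero = sym (trans (adj-sym (suc zero) zero) adj01)
  p2adj≡adj (suc zero) (suc zero) = sym (irrefl (suc zero))

≡-squeeze : ∀ {a b c} → a ≤ b → b ≤ c → (a ≡ c) ⇔ (a ≡ b × b ≡ c)
≡-squeeze a≤b b≤c = mk⇔ (λ { refl → let a≡b = ≤-antisym a≤b b≤c in a≡b , sym a≡b }) (λ (a≡b , b≡c) → trans a≡b b≡c)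

n≡2⊎3≤n : ∀ {m} → 2 ≤ m → m ≡ 2 ⊎ 3 ≤ m
n≡2⊎3≤n {1} (s≤s ())
n≡2⊎3≤n {2} _ = inj₁ refl
n≡2⊎3≤n {suc (suc (suc _))} _ = inj₂ (s≤s (s≤s (s≤s z≤n)))

gap-consequences : ∀ {t q} → 2 ≤ t → t + 2 ≤ q ⊎ (t ≡ 2 × 3 ≤ q) → t < q × ((q ≡ t + 1) ⇔ (q ≡ 3))
gap-consequences {t} {q} 2≤t (inj₁ t+2≤q) = <-≤-trans (m<m+n t (s≤s z≤n)) t+2≤q , mk⇔ absurdˡ absurdʳ
  where
  absurdˡ : q ≡ t + 1 → q ≡ 3
  absurdˡ refl = contradiction (+-cancelˡ-≤ t 2 1 t+2≤q) λ { (s≤s ()) }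
  absurdʳ : q ≡ 3 → q ≡ t + 1
  absurdʳ refl = contradiction (≤-trans (+-monoˡ-≤ 2 2≤t) t+2≤q) λ { (s≤s (s≤s (s≤s ()))) }
gap-consequences _ (inj₂ (refl , 3≤q)) = 3≤q , mk⇔ id id

module Properties (G : Graph) where

  Adj? : ∀ x y → Dec (Adj G x y)
  Adj? x y = adj G x y Bool.≟ true

  Adj-sym : ∀ {x y} → Adj G x y → Adj G y x
  Adj-sym {x} {y} xy = trans (Graph.sym G y x) xy

  Adj⇒≢ : ∀ {x y} → Adj G x y → x ≢ y
  Adj⇒≢ {x} xx refl with trans (sym xx) (irrefl G x)
  ... | ()

  N[_] : Fin (n G) → Subset (n G)
  N[ v ] = subsetOf (λ x → x Finₚ.≟ v ⊎-dec Adj? v x)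

  ∈N[]⁺ : ∀ {v x} → x ≡ v ⊎ Adj G v x → x ∈ N[ v ]
  ∈N[]⁺ {v} = ∈subsetOf⁺ (λ x → x Finₚ.≟ v ⊎-dec Adj? v x)

  ∈N[]⁻ : ∀ {v x} → x ∈ N[ v ] → x ≡ v ⊎ Adj G v x
  ∈N[]⁻ {v} = ∈subsetOf⁻ (λ x → x Finₚ.≟ v ⊎-dec Adj? v x)

  Reach⇒first-step : ∀ {x z} → Reach G x z → x ≢ z → ∃ (Adj G x)
  Reach⇒first-step here x≢x = ⊥-elim (x≢x refl)
  Reach⇒first-step (step xy _) _ = _ , xy

  boundary-edge : ∀ (p : Subset (n G)) {x z} → Reach G x z → x ∈ p → z ∉ p →
                  ∃₂ λ y y′ → Adj G y y′ × y ∈ p × y′ ∉ p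
  boundary-edge p here x∈p z∉p = ⊥-elim (z∉p x∈p)
  boundary-edge p (step {v = v} xv r) x∈p z∉p with v ∈? p
  ... | yes v∈p = boundary-edge p r v∈p z∉p
  ... | no v∉p = _ , v , xv , x∈p , v∉p

  twice-IsTRDF : ∀ {S} → IsTotalDominating G S → IsTRDF G (twice S)
  twice-IsTRDF {S} tds = dominated , not-isolated
    where
    twice-∈ : ∀ {y} → y ∈ S → twice S y ≡ L2
    twice-∈ y∈S = cong (if_then L2 else L0) ([]=⇒lookup y∈S)
    dominated : IsRDF G (twice S)
    dominated u _ = let (y , uy , y∈S) = tds u in y , uy , twice-∈ y∈S
    not-isolated : ∀ x → ¬ IsolatedInPositive G (twice S) x
    not-isolated x (_ , isolated) with tds x
    ... | y , xy , y∈S with trans (sym (twice-∈ y∈S)) (isolated y xy)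
    ...   | ()

  IsTRDF⇒IsQTRDF : ∀ {f} → IsTRDF G f → IsQTRDF G f
  IsTRDF⇒IsQTRDF (rdf , no-isolated) = rdf , λ x isolated → ⊥-elim (no-isolated x isolated)

  L1-IsQTRDF : IsQTRDF G (λ _ → L1)
  L1-IsQTRDF = (λ _ ()) , (λ _ _ → refl)

  module _ (f : Fin (n G) → Label) where

    PositiveNeighbour : Fin (n G) → Set
    PositiveNeighbour x = ∃ λ y → Adj G x y × f y ≢ L0

    positiveNeighbour? : ∀ x → Dec (PositiveNeighbour x)
    positiveNeighbour? x = Finₚ.any? (λ y → Adj? x y ×-dec ¬? (f y ≟ᴸ L0))

    L2⇒PositiveNeighbour : IsQTRDF G f → ∀ {x} → f x ≡ L2 → PositiveNeighbour x
    L2⇒PositiveNeighbour (_ , isolated⇒L1) {x} fx≡L2 with positiveNeighbour? x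
    ... | yes pn = pn
    ... | no ¬pn = contradiction (trans (sym fx≡L2) (isolated⇒L1 x (positive , neighbours-L0))) λ ()
      where
      positive : f x ≢ L0
      positive fx≡L0 = contradiction (trans (sym fx≡L2) fx≡L0) λ ()
      neighbours-L0 : ∀ y → Adj G x y → f y ≡ L0
      neighbours-L0 y xy = decidable-stable (f y ≟ᴸ L0) (λ fy≢L0 → ¬pn (y , xy , fy≢L0))

    no-L2⇒all-L1 : IsRDF G f → (∀ x → f x ≢ L2) → ∀ x → f x ≡ L1
    no-L2⇒all-L1 rdf no-L2 x with f x in fx
    ... | L0 = ⊥-elim (no-L2 _ (proj₂ (proj₂ (rdf x fx))))
    ... | L1 = refl
    ... | L2 = ⊥-elim (no-L2 x fx)

  module ConnectedNontrivial (nontrivial : Nontrivial G) (connected : Connected G) where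

    some-vertex : Fin (n G)
    some-vertex = fromℕ< nontrivial

    neighbour : ∀ x → ∃ (Adj G x)
    neighbour x = let (z , z≢x) = avoid-one nontrivial x in
                  Reach⇒first-step (connected x z) (z≢x ∘ sym)

    nb : Fin (n G) → Fin (n G)
    nb x = proj₁ (neighbour x)

    nb-Adj : ∀ x → Adj G x (nb x)
    nb-Adj x = proj₂ (neighbour x)

    vertex-of-degree-two : 3 ≤ n G → ∃ λ v → ∃₂ λ a b → Adj G v a × Adj G v b × a ≢ b
    vertex-of-degree-two n≥3 with neighbour some-vertex
    ... | a , xa with avoid-two n≥3 some-vertex a
    ...   | z , z≢x , z≢a with boundary-edge (pair some-vertex a) (connected some-vertex z)
                                 (∈pair⁺ _ _ (inj₁ refl)) ([ z≢x , z≢a ]′ ∘ ∈pair⁻ _ _)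
    ...     | y , y′ , yy′ , y∈ , y′∉ with ∈pair⁻ _ _ y∈
    ...       | inj₁ refl = _ , a , y′ , xa , yy′ , y′∉ ∘ ∈pair⁺ _ _ ∘ inj₂ ∘ sym
    ...       | inj₂ refl = _ , some-vertex , y′ , Adj-sym xa , yy′ , y′∉ ∘ ∈pair⁺ _ _ ∘ inj₁ ∘ sym

    TDS-around-edge : ∀ {v z} (R : Subset (n G)) → Adj G v z → (∀ {x} → x ∉ N[ v ] → x ∈ R ⊎ Adj G x z) →
                      ∃ λ S → IsTotalDominating G S × ∣ S ∣ ≤ 2 + ∣ R ∣
    TDS-around-edge {v} {z} R vz far = S , dominating , size
      where
      S = ⁅ v ⁆ ∪ ⁅ z ⁆ ∪ image nb R
      v∈S : v ∈ S
      v∈S = x∈p∪q⁺ (inj₁ (x∈⁅x⁆ v))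
      z∈S : z ∈ S
      z∈S = x∈p∪q⁺ (inj₂ (x∈p∪q⁺ (inj₁ (x∈⁅x⁆ z))))
      nb∈S : ∀ {x} → x ∈ R → nb x ∈ S
      nb∈S x∈R = x∈p∪q⁺ (inj₂ (x∈p∪q⁺ (inj₂ (∈image⁺ nb x∈R))))
      dominating : IsTotalDominating G S
      dominating x with x ∈? N[ v ]
      ... | yes x∈N[v] = [ (λ { refl → z , vz , z∈S }) , (λ vx → v , Adj-sym vx , v∈S) ]′ (∈N[]⁻ x∈N[v])
      ... | no x∉N[v] = [ (λ x∈R → nb x , nb-Adj x , nb∈S x∈R) , (λ xz → z , xz , z∈S) ]′ (far x∉N[v])
      size : ∣ S ∣ ≤ 2 + ∣ R ∣
      size = ≤-trans (∣⁅x⁆∪p∣≤1+∣p∣ v _) (s≤s (≤-trans (∣⁅x⁆∪p∣≤1+∣p∣ z _) (s≤s (∣image∣≤∣p∣ nb R))))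

    -- z is taken on an edge leaving V ∖ N[v], so that it also dominates that edge's endpoint y.
    closed-neighbourhood-TDS : ∀ v → ∃ λ S → IsTotalDominating G S × (∣ S ∣ ≤ 2 ⊎ ∣ S ∣ ≤ suc ∣ ∁ N[ v ] ∣)
    closed-neighbourhood-TDS v with nonempty? (∁ N[ v ])
    ... | no ∁N[v]-empty =
      let S , dominating , size = TDS-around-edge ⊥ (nb-Adj v) (λ x∉N[v] → ⊥-elim (∁N[v]-empty (_ , x∉p⇒x∈∁p x∉N[v])))
      in S , dominating , inj₁ (≤-trans size (≤-reflexive (cong (2 +_) (∣⊥∣≡0 (n G)))))
    ... | yes (y₀ , y₀∈∁N[v]) with boundary-edge (∁ N[ v ]) (connected y₀ v) y₀∈∁N[v] (x∈p⇒x∉∁p (∈N[]⁺ (inj₁ refl)))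
    ...   | y , z , yz , y∈∁N[v] , z∉∁N[v] =
      let S , dominating , size = TDS-around-edge (∁ N[ v ] - y) vz far
      in S , dominating , inj₂ (≤-trans size (s≤s (x∈p⇒∣p-x∣<∣p∣ y∈∁N[v])))
      where
      y∉N[v] = x∈∁p⇒x∉p y∈∁N[v]
      vz : Adj G v z
      vz = [ (λ z≡v → ⊥-elim (y∉N[v] (∈N[]⁺ (inj₂ (Adj-sym (subst (Adj G y) z≡v yz)))))) , (λ vz → vz) ]′
             (∈N[]⁻ (x∉∁p⇒x∈p z∉∁N[v]))
      far : ∀ {x} → x ∉ N[ v ] → x ∈ ∁ N[ v ] - y ⊎ Adj G x z
      far {x} x∉N[v] with x Finₚ.≟ y
      ... | yes refl = inj₂ yz
      ... | no x≢y = inj₁ (x∈p∧x≢y⇒x∈p-y (x∉p⇒x∈∁p x∉N[v]) x≢y)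

    SmallTDS : ℕ → Set
    SmallTDS w = ∃ λ S → IsTotalDominating G S × (∣ S ∣ + 2 ≤ w ⊎ (∣ S ∣ ≤ 2 × 3 ≤ w))

    closed-neighbourhood-SmallTDS : ∀ {w} v → 3 + ∣ ∁ N[ v ] ∣ ≤ w → SmallTDS w
    closed-neighbourhood-SmallTDS v bound with closed-neighbourhood-TDS v
    ... | S , dominating , inj₁ ∣S∣≤2 = S , dominating , inj₂ (∣S∣≤2 , ≤-trans (m≤m+n 3 _) bound)
    ... | S , dominating , inj₂ ∣S∣≤1+∣∁N[v]∣ =
      S , dominating , inj₁ (≤-trans (+-monoˡ-≤ 2 ∣S∣≤1+∣∁N[v]∣) (≤-trans (≤-reflexive (+-comm _ 2)) bound))

    module _ {f : Fin (n G) → Label} (qtrdf : IsQTRDF G f) where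

      private
        rdf = proj₁ qtrdf

      many-L2 : 2 ≤ ∣ V₂ f ∣ → SmallTDS (weight G f)
      many-L2 ∣V₂∣≥2 = S , dominating , inj₁ size
        where
        -- A vertex of V₁ is kept when it has a positive neighbour, which may depend on it,
        -- and is replaced by one of its neighbours otherwise.
        anchor : Fin (n G) → Fin (n G)
        anchor x with positiveNeighbour? f x
        ... | yes _ = x
        ... | no _ = nb x
        anchor-fixed : ∀ {x} → PositiveNeighbour f x → anchor x ≡ x
        anchor-fixed {x} pn with positiveNeighbour? f x
        ... | yes _ = refl
        ... | no ¬pn = ⊥-elim (¬pn pn)
        anchor-Adj : ∀ {x} → ¬ PositiveNeighbour f x → Adj G x (anchor x)
        anchor-Adj {x} ¬pn with positiveNeighbour? f x
        ... | yes pn = ⊥-elim (¬pn pn)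
        ... | no _ = nb-Adj x
        S = V₂ f ∪ image anchor (V₁ f)
        positive∈S : ∀ {y} → PositiveNeighbour f y → f y ≢ L0 → y ∈ S
        positive∈S {y} pn fy≢L0 with f y ≟ᴸ L2
        ... | yes fy≡L2 = x∈p∪q⁺ (inj₁ (∈V₂⁺ f fy≡L2))
        ... | no fy≢L2 = x∈p∪q⁺ (inj₂ (subst (_∈ image anchor (V₁ f)) (anchor-fixed pn)
                                        (∈image⁺ anchor (∈V₁⁺ f (≢L0∧≢L2⇒≡L1 fy≢L0 fy≢L2)))))
        dominating : IsTotalDominating G S
        dominating x with f x ≟ᴸ L0
        ... | yes fx≡L0 = let y , xy , fy≡L2 = rdf x fx≡L0 in y , xy , x∈p∪q⁺ (inj₁ (∈V₂⁺ f fy≡L2))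
        ... | no fx≢L0 with positiveNeighbour? f x
        ...   | yes (y , xy , fy≢L0) = y , xy , positive∈S (x , Adj-sym xy , fx≢L0) fy≢L0
        ...   | no ¬pn = anchor x , anchor-Adj ¬pn , x∈p∪q⁺ (inj₂ (∈image⁺ anchor (∈V₁⁺ f fx≡L1)))
          where fx≡L1 = ≢L0∧≢L2⇒≡L1 fx≢L0 (¬pn ∘ L2⇒PositiveNeighbour f qtrdf)
        size : ∣ S ∣ + 2 ≤ weight G f
        size = begin
          ∣ S ∣ + 2                       ≤⟨ +-monoˡ-≤ 2 (≤-trans (∣p∪q∣≤∣p∣+∣q∣ (V₂ f) _)
                                                              (+-monoʳ-≤ ∣ V₂ f ∣ (∣image∣≤∣p∣ anchor (V₁ f)))) ⟩
          ∣ V₂ f ∣ + ∣ V₁ f ∣ + 2         ≤⟨ +-monoʳ-≤ (∣ V₂ f ∣ + ∣ V₁ f ∣) ∣V₂∣≥2 ⟩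
          ∣ V₂ f ∣ + ∣ V₁ f ∣ + ∣ V₂ f ∣  ≡⟨ solve 2 (λ a b → b :+ a :+ b := a :+ con 2 :* b) refl ∣ V₁ f ∣ ∣ V₂ f ∣ ⟩
          ∣ V₁ f ∣ + 2 * ∣ V₂ f ∣         ≡⟨ sumFin-val≡∣V₁∣+2∣V₂∣ f ⟨
          weight G f                      ∎
          where open ≤-Reasoning

      one-L2 : ∀ {v} → ∣ V₂ f ∣ ≤ 1 → f v ≡ L2 → SmallTDS (weight G f)
      one-L2 {v} ∣V₂∣≤1 fv≡L2 with L2⇒PositiveNeighbour f qtrdf fv≡L2
      ... | u , vu , fu≢L0 = closed-neighbourhood-SmallTDS v bound
        where
        only-v : ∀ {x} → f x ≡ L2 → x ≡ v
        only-v fx≡L2 = ∣p∣≤1∧x∈p∧y∈p⇒x≡y ∣V₂∣≤1 (∈V₂⁺ f fx≡L2) (∈V₂⁺ f fv≡L2)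
        u∈V₁ : u ∈ V₁ f
        u∈V₁ = ∈V₁⁺ f (≢L0∧≢L2⇒≡L1 fu≢L0 (Adj⇒≢ vu ∘ sym ∘ only-v))
        ∁N[v]⊆V₁-u : ∁ N[ v ] ⊆ V₁ f - u
        ∁N[v]⊆V₁-u {x} x∈∁N[v] = x∈p∧x≢y⇒x∈p-y (∈V₁⁺ f (≢L0∧≢L2⇒≡L1 fx≢L0 (x≢v ∘ only-v))) (λ { refl → ¬vx vu })
          where
          x≢v = x∈∁p⇒x∉p x∈∁N[v] ∘ ∈N[]⁺ ∘ inj₁
          ¬vx = x∈∁p⇒x∉p x∈∁N[v] ∘ ∈N[]⁺ ∘ inj₂
          fx≢L0 : f x ≢ L0
          fx≢L0 fx≡L0 = let y , xy , fy≡L2 = rdf x fx≡L0 in ¬vx (Adj-sym (subst (Adj G x) (only-v fy≡L2) xy))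
        bound : 3 + ∣ ∁ N[ v ] ∣ ≤ weight G f
        bound = begin
          3 + ∣ ∁ N[ v ] ∣          ≡⟨ +-comm 2 _ ⟩
          suc ∣ ∁ N[ v ] ∣ + 2      ≤⟨ +-monoˡ-≤ 2 (<-≤-trans (s≤s (p⊆q⇒∣p∣≤∣q∣ ∁N[v]⊆V₁-u)) (x∈p⇒∣p-x∣<∣p∣ u∈V₁)) ⟩
          ∣ V₁ f ∣ + 2 * 1          ≡⟨ cong (λ k → ∣ V₁ f ∣ + 2 * k) (≤-antisym ∣V₂∣≤1 (x∈p⇒0<∣p∣ (∈V₂⁺ f fv≡L2))) ⟨
          ∣ V₁ f ∣ + 2 * ∣ V₂ f ∣   ≡⟨ sumFin-val≡∣V₁∣+2∣V₂∣ f ⟨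
          weight G f                ∎
          where open ≤-Reasoning

      weight≡n : (∀ x → f x ≢ L2) → weight G f ≡ n G
      weight≡n no-L2 = sumFin-val-L1 f (no-L2⇒all-L1 f rdf no-L2)

      no-L2 : 3 ≤ n G → (∀ x → f x ≢ L2) → SmallTDS (weight G f)
      no-L2 n≥3 no-L2 with vertex-of-degree-two n≥3
      ... | v , a , b , va , vb , a≢b = closed-neighbourhood-SmallTDS v bound
        where
        ∁N[v]⊆⊤-v-a-b : ∁ N[ v ] ⊆ ⊤ - v - a - b
        ∁N[v]⊆⊤-v-a-b {x} x∈∁N[v] =
          x∈p∧x≢y⇒x∈p-y (x∈p∧x≢y⇒x∈p-y (x∈p∧x≢y⇒x∈p-y ∈⊤ (x∉N[v] ∘ ∈N[]⁺ ∘ inj₁))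
                                        (λ { refl → x∉N[v] (∈N[]⁺ (inj₂ va)) }))
                        (λ { refl → x∉N[v] (∈N[]⁺ (inj₂ vb)) })
          where x∉N[v] = x∈∁p⇒x∉p x∈∁N[v]
        a∈⊤-v = x∈p∧x≢y⇒x∈p-y ∈⊤ (Adj⇒≢ va ∘ sym)
        b∈⊤-v-a = x∈p∧x≢y⇒x∈p-y (x∈p∧x≢y⇒x∈p-y ∈⊤ (Adj⇒≢ vb ∘ sym)) (a≢b ∘ sym)
        bound : 3 + ∣ ∁ N[ v ] ∣ ≤ weight G f
        bound = begin
          3 + ∣ ∁ N[ v ] ∣          ≤⟨ +-monoʳ-≤ 3 (p⊆q⇒∣p∣≤∣q∣ ∁N[v]⊆⊤-v-a-b) ⟩
          3 + ∣ ⊤ - v - a - b ∣     ≤⟨ s≤s (s≤s (x∈p⇒∣p-x∣<∣p∣ b∈⊤-v-a)) ⟩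
          2 + ∣ ⊤ - v - a ∣         ≤⟨ s≤s (x∈p⇒∣p-x∣<∣p∣ a∈⊤-v) ⟩
          1 + ∣ ⊤ - v ∣             ≤⟨ x∈p⇒∣p-x∣<∣p∣ (∈⊤ {x = v}) ⟩
          ∣ ⊤ {n G} ∣               ≡⟨ ∣⊤∣≡n (n G) ⟩
          n G                       ≡⟨ weight≡n no-L2 ⟨
          weight G f                ∎
          where open ≤-Reasoning

      QTRDF-SmallTDS : 3 ≤ n G → SmallTDS (weight G f)
      QTRDF-SmallTDS n≥3 with 2 ≤? ∣ V₂ f ∣ | nonempty? (V₂ f)
      ... | yes ∣V₂∣≥2 | _ = many-L2 ∣V₂∣≥2
      ... | no ∣V₂∣≱2 | yes (v , v∈V₂) = one-L2 (≤-pred (≰⇒> ∣V₂∣≱2)) (∈V₂⁻ f v∈V₂)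
      ... | no _ | no V₂-empty = no-L2 n≥3 (λ x fx≡L2 → V₂-empty (x , ∈V₂⁺ f fx≡L2))

      2≤weight : 2 ≤ weight G f
      2≤weight with nonempty? (V₂ f)
      ... | yes (_ , v∈V₂) = ≤-trans (*-monoʳ-≤ 2 (x∈p⇒0<∣p∣ v∈V₂))
                                     (≤-trans (m≤n+m _ ∣ V₁ f ∣) (≤-reflexive (sym (sumFin-val≡∣V₁∣+2∣V₂∣ f))))
      ... | no V₂-empty = subst (2 ≤_) (sym (weight≡n (λ x fx≡L2 → V₂-empty (x , ∈V₂⁺ f fx≡L2)))) nontrivial

    2≤∣TDS∣ : ∀ {S} → IsTotalDominating G S → 2 ≤ ∣ S ∣
    2≤∣TDS∣ dominating =
      let u , _ , u∈S = dominating some-vertex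
          u′ , uu′ , u′∈S = dominating u
      in x∈p∧y∈p∧x≢y⇒2≤∣p∣ u∈S u′∈S (Adj⇒≢ uu′)

    ⊤-IsTotalDominating : IsTotalDominating G ⊤
    ⊤-IsTotalDominating x = nb x , nb-Adj x , ∈⊤

    module Bounds {γt γqtR : ℕ} (isγt : IsTotalDomNumber G γt) (isγqtR : IsQTRDNumber G γqtR) where

      private
        S-dominating = proj₁ (proj₂ (proj₁ isγt))
        ∣S∣≡γt = proj₂ (proj₂ (proj₁ isγt))
        γt-minimal = proj₂ isγt
        f-QTRDF = proj₁ (proj₂ (proj₁ isγqtR))
        weight≡γqtR = proj₂ (proj₂ (proj₁ isγqtR))
        γqtR-minimal = proj₂ isγqtR

      2≤γt : 2 ≤ γt
      2≤γt = subst (2 ≤_) ∣S∣≡γt (2≤∣TDS∣ S-dominating)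

      n≡2⇒γt≡2∧γqtR≡2 : n G ≡ 2 → γt ≡ 2 × γqtR ≡ 2
      n≡2⇒γt≡2∧γqtR≡2 n≡2 =
        ≤-antisym (≤-trans (γt-minimal ⊤ ⊤-IsTotalDominating) (≤-reflexive (trans (∣⊤∣≡n (n G)) n≡2))) 2≤γt ,
        ≤-antisym (≤-trans (γqtR-minimal _ L1-IsQTRDF) (≤-reflexive (trans (sumFin-val-L1 _ (λ _ → refl)) n≡2)))
                  (subst (2 ≤_) weight≡γqtR (2≤weight f-QTRDF))

      3≤n⇒gap : 3 ≤ n G → γt + 2 ≤ γqtR ⊎ (γt ≡ 2 × 3 ≤ γqtR)
      3≤n⇒gap n≥3 with QTRDF-SmallTDS f-QTRDF n≥3
      ... | S , dominating , inj₁ ∣S∣+2≤w =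
        inj₁ (≤-trans (+-monoˡ-≤ 2 (γt-minimal S dominating)) (subst (∣ S ∣ + 2 ≤_) weight≡γqtR ∣S∣+2≤w))
      ... | S , dominating , inj₂ (∣S∣≤2 , 3≤w) =
        inj₂ (≤-antisym (≤-trans (γt-minimal S dominating) ∣S∣≤2) 2≤γt , subst (3 ≤_) weight≡γqtR 3≤w)

      γt≤γqtR : γt ≤ γqtR
      γt≤γqtR with n≡2⊎3≤n nontrivial
      ... | inj₁ n≡2 = let γt≡2 , γqtR≡2 = n≡2⇒γt≡2∧γqtR≡2 n≡2 in ≤-reflexive (trans γt≡2 (sym γqtR≡2))
      ... | inj₂ n≥3 = <⇒≤ (proj₁ (gap-consequences 2≤γt (3≤n⇒gap n≥3)))

      γqtR≡γt⇔n≡2 : (γqtR ≡ γt) ⇔ (n G ≡ 2)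
      γqtR≡γt⇔n≡2 = mk⇔ only-if (λ n≡2 → let γt≡2 , γqtR≡2 = n≡2⇒γt≡2∧γqtR≡2 n≡2 in trans γqtR≡2 (sym γt≡2))
        where
        only-if : γqtR ≡ γt → n G ≡ 2
        only-if γqtR≡γt with n≡2⊎3≤n nontrivial
        ... | inj₁ n≡2 = n≡2
        ... | inj₂ n≥3 = contradiction (sym γqtR≡γt) (<⇒≢ (proj₁ (gap-consequences 2≤γt (3≤n⇒gap n≥3))))

      γqtR≡γt+1⇔γqtR≡3 : (γqtR ≡ γt + 1) ⇔ (γqtR ≡ 3)
      γqtR≡γt+1⇔γqtR≡3 with n≡2⊎3≤n nontrivial
      ... | inj₁ n≡2 with n≡2⇒γt≡2∧γqtR≡2 n≡2
      ...   | refl , refl = mk⇔ (λ ()) (λ ())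
      γqtR≡γt+1⇔γqtR≡3 | inj₂ n≥3 = proj₂ (gap-consequences 2≤γt (3≤n⇒gap n≥3))

    γqtR≤γtR : ∀ {γqtR γtR} → IsQTRDNumber G γqtR → IsTRDNumber G γtR → γqtR ≤ γtR
    γqtR≤γtR (_ , γqtR-minimal) ((f , f-TRDF , weight≡γtR) , _) =
      subst (_ ≤_) weight≡γtR (γqtR-minimal f (IsTRDF⇒IsQTRDF f-TRDF))

    γtR≤2γt : ∀ {γt γtR} → IsTotalDomNumber G γt → IsTRDNumber G γtR → γtR ≤ 2 * γt
    γtR≤2γt ((S , S-dominating , ∣S∣≡γt) , _) (_ , γtR-minimal) =
      subst (_ ≤_) (trans (sumFin-val-twice S) (cong (2 *_) ∣S∣≡γt)) (γtR-minimal (twice S) (twice-IsTRDF S-dominating))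

mainTheorem2 : (G : Graph) → Nontrivial G → Connected G →
    (γt γqtR γtR : ℕ) →
    IsTotalDomNumber G γt → IsQTRDNumber G γqtR → IsTRDNumber G γtR →
    (γt ≤ γqtR × γqtR ≤ 2 * γt)
    × ((γqtR ≡ γt) ⇔ (G ≅ P₂))
    × ((γqtR ≡ γt + 1) ⇔ (γqtR ≡ 3))
    × ((γqtR ≡ 2 * γt) ⇔ (γqtR ≡ γtR × γtR ≡ 2 * γt))
mainTheorem2 G nontrivial connected γt γqtR γtR isγt isγqtR isγtR =
  (γt≤γqtR , ≤-trans (γqtR≤γtR isγqtR isγtR) (γtR≤2γt isγt isγtR)) ,
  mk⇔ (λ γqtR≡γt → n≡2⇒≅P₂ G (Equivalence.to γqtR≡γt⇔n≡2 γqtR≡γt) neighbour)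
      (Equivalence.from γqtR≡γt⇔n≡2 ∘ ≅P₂⇒n≡2 {G}) ,
  γqtR≡γt+1⇔γqtR≡3 ,
  ≡-squeeze (γqtR≤γtR isγqtR isγtR) (γtR≤2γt isγt isγtR)
  where
  open Properties G
  open ConnectedNontrivial nontrivial connected
  open Bounds isγt isγqtR
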